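{- Let $n\ge1$ and let two $B$-diagonals have arc representations $\{[u_1,v_1-1],[u_1+n+1,v_1+n]\}$ and $\{[u_2,v_2-1],[u_2+n+1,v_2+n]\}$. These two $B$-diagonals are noncrossing if and only if for every arc $I\in\{[u_1,v_1-1],[u_1+n+1,v_1+n]\}$ and every arc $J\in\{[u_2,v_2-1],[u_2+n+1,v_2+n]\}$, the arcs $I$ and $J$ are either nested (one contains the other) or disjoint.
   Context: Label the vertices of a regular $(2n+2)$-gon clockwise by $1,\ldots,n+1,\overline{1},\ldots,\overline{n+1}$, identify $\overline{i}$ with $n+1+i$, and read labels as elements of $\mathbb{Z}/(2n+2)\mathbb{Z}\subset\mathbb{R}/(2n+2)\mathbb{Z}$. A $B$-diagonal is either a diameter $\{i,\overline{i}\}$ ($1\le i\le n+1$), or an antipodal pair of diagonals $\{\{i,j\},\{\overline{i},\overline{j}\}\}$ with $1\le i<i+1<j\le n+1$, or $\{\{i,\overline{j}\},\{\overline{i},j\}\}$ with $1\le j<i\le n+1$. Two $B$-diagonals cross if a diagonal of one and a diagonal of the other meet in the interior of the polygon. Every $B$-diagonal can be written as $\{\{u,v\},\{u+n+1,v+n+1\}\}$ with $v-u\equiv d\pmod{2n+2}$ for some $d\in\{2,\ldots,n+1\}$; its arc representation is the centrally symmetric pair of closed arcs $\{[u,v-1],[u+n+1,v+n]\}$ on the circle $\mathbb{R}/(2n+2)\mathbb{Z}$, where $[x,y]$ denotes the arc traversed increasingly from $x$ to $y$ (of length less than $n+1$). This pair does not depend on the choices made. -}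

module Defs where

open import Data.Nat using (ℕ; zero; suc; _+_; _*_; _∸_; _≤_; _<_; NonZero)
open import Data.Nat.DivMod using (_%_)
open import Data.Bool using (Bool; true; false)
open import Data.Product using (_×_; _,_)
open import Data.Sum using (_⊎_)
open import Data.Empty using (⊥)
open import Relation.Nullary using (¬_)
open import Relation.Binary.PropositionalEquality using (_≡_; _≢_)

-- The (2n+2)-gon.  Vertex labels are elements of ℤ/(2n+2)ℤ, represented
-- by natural numbers read modulo N = 2n+2.  Label i (1 ≤ i ≤ n+1) is i,
-- label ī is n+1+i.

N : ℕ → ℕ
N n = suc (suc (n + n))

⟦_⟧_ : ℕ → ℕ → ℕ
⟦ a ⟧ n = a % N n

_≡[_]_ : ℕ → ℕ → ℕ → Set
a ≡[ n ] b = (⟦ a ⟧ n) ≡ (⟦ b ⟧ n)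

bar : ℕ → ℕ → ℕ
bar n i = suc n + i

dist : ℕ → ℕ → ℕ → ℕ
dist n a b = ((⟦ b ⟧ n) + N n ∸ (⟦ a ⟧ n)) % N n

Chord : Set
Chord = ℕ × ℕ

ChordEq : ℕ → Chord → Chord → Set
ChordEq n (a , b) (c , d) =
  (a ≡[ n ] c × b ≡[ n ] d) ⊎ (a ≡[ n ] d × b ≡[ n ] c)

StrictlyBetween : ℕ → ℕ → ℕ → ℕ → Set
StrictlyBetween n a b c = (0 < dist n a c) × (dist n a c < dist n a b)

ChordsCross : ℕ → Chord → Chord → Set
ChordsCross n (a , b) (c , d) =
  ¬ (a ≡[ n ] b) × ¬ (a ≡[ n ] c) × ¬ (a ≡[ n ] d) ×
  ¬ (b ≡[ n ] c) × ¬ (b ≡[ n ] d) × ¬ (c ≡[ n ] d) ×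
  ((StrictlyBetween n a b c × ¬ StrictlyBetween n a b d) ⊎
   (¬ StrictlyBetween n a b c × StrictlyBetween n a b d))

data BDiag (n : ℕ) : Set where
  diam  : (i : ℕ) → 1 ≤ i → i ≤ suc n → BDiag n
  same  : (i j : ℕ) → 1 ≤ i → suc i < j → j ≤ suc n → BDiag n
  mixed : (i j : ℕ) → 1 ≤ j → j < i → i ≤ suc n → BDiag n

chords : {n : ℕ} → BDiag n → Chord × Chord
chords {n} (diam i _ _)      = (i , bar n i) , (i , bar n i)
chords {n} (same i j _ _ _)  = (i , j) , (bar n i , bar n j)
chords {n} (mixed i j _ _ _) = (i , bar n j) , (bar n i , j)

Cross : {n : ℕ} → BDiag n → BDiag n → Set
Cross {n} D E with chords D | chords E
... | c₁ , c₂ | e₁ , e₂ =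
  ChordsCross n c₁ e₁ ⊎ ChordsCross n c₁ e₂ ⊎
  ChordsCross n c₂ e₁ ⊎ ChordsCross n c₂ e₂

Noncrossing : {n : ℕ} → BDiag n → BDiag n → Set
Noncrossing D E = ¬ Cross D E

WrittenAs : {n : ℕ} → BDiag n → ℕ → ℕ → Set
WrittenAs {n} D u v with chords D
... | c₁ , c₂ =
  (Data.Product.Σ ℕ λ d → (2 ≤ d) × (d ≤ suc n) × (v ≡[ n ] (u + d))) ×
  ((ChordEq n c₁ e₁ × ChordEq n c₂ e₂) ⊎ (ChordEq n c₁ e₂ × ChordEq n c₂ e₁))
  where
    e₁ e₂ : Chord
    e₁ = (u , v)
    e₂ = (u + suc n , v + suc n)

-- Arcs on the circle ℝ/(2n+2)ℤ with integer endpoints.  A closed arc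
-- [x,y] (traversed increasingly from x to y) is represented by the set
-- of integer points it contains.

InArc : ℕ → ℕ → ℕ → ℕ → Set
InArc n x y p = dist n x p ≤ dist n x y

NestedOrDisjoint : ℕ → (ℕ × ℕ) → (ℕ × ℕ) → Set
NestedOrDisjoint n (x , y) (x' , y') =
  (∀ p → InArc n x y p → InArc n x' y' p) ⊎
  (∀ p → InArc n x' y' p → InArc n x y p) ⊎
  (∀ p → InArc n x y p → InArc n x' y' p → ⊥)

shift : ℕ → Bool → ℕ
shift n false = 0
shift n true  = suc n

-- the arc representation {[u,v-1],[u+n+1,v+n]}: false ↦ [u,v-1],
-- true ↦ [u+n+1,v+n]  (v-1 is represented by v + (N-1))
arcOf : ℕ → ℕ → ℕ → Bool → ℕ × ℕ
arcOf n u v b = (u + shift n b , v + (N n ∸ 1) + shift n b)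

module Submission where

-- Measure every vertex by its clockwise distance from the first endpoint a of
-- one diagonal.  The diagonal {a, a+d} and its arc [a, a+d-1] become {0, d} and
-- [0, d-1]; a second diagonal {c, c+e} with arc [c, c+e-1] sits at s = dist a c
-- and t ≡ s + e.  A case analysis on the position of s and on whether s + e
-- wraps past 0 shows that the arcs overlap without being nested exactly when
-- exactly one of s, t lies strictly between 0 and d, i.e. when the diagonals
-- cross.  This needs d + e ≤ 2n+2 (two arcs never cover the circle), which holds
-- because both arcs of an arc representation have length at most n+1.  A
-- B-diagonal consists of the diagonals {u+h, v+h}, h ∈ {0, n+1}, whose arcs are
-- [u+h, v-1+h], so the theorem follows pair by pair.

open import Defs
open import Data.Bool using (Bool; true; false)
open import Data.Empty using (⊥; ⊥-elim)
open import Data.Nat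
open import Data.Nat.DivMod
open import Data.Nat.Properties
open import Algebra.Properties.CommutativeSemigroup +-commutativeSemigroup using (xy∙z≈xz∙y)
open import Data.Product
open import Data.Product.Function.NonDependent.Propositional using (_×-⇔_)
open import Data.Sum using (_⊎_; inj₁; inj₂)
open import Data.Sum.Function.Propositional using (_⊎-⇔_)
open import Function using (_∘_)
open import Function.Bundles using (_⇔_; mk⇔; Equivalence)
open import Function.Properties.Equivalence using () renaming (refl to ⇔-refl; trans to ⇔-trans)
open import Function.Related.TypeIsomorphisms using (¬-cong-⇔)
open import Relation.Nullary
open import Relation.Binary.PropositionalEquality

infix 1 _xor_
_xor_ : Set → Set → Set
A xor B = (A × ¬ B) ⊎ (¬ A × B)

xor-cong-⇔ : ∀ {A A' B B' : Set} → A ⇔ A' → B ⇔ B' → (A xor B) ⇔ (A' xor B')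
xor-cong-⇔ A⇔A' B⇔B' = (A⇔A' ×-⇔ ¬-cong-⇔ B⇔B') ⊎-⇔ (¬-cong-⇔ A⇔A' ×-⇔ B⇔B')

xor⇒⇔¬ : ∀ {A B : Set} → A xor B → B ⇔ (¬ A)
xor⇒⇔¬ (inj₁ (a , ¬b)) = mk⇔ (λ b → ⊥-elim (¬b b)) (λ ¬a → ⊥-elim (¬a a))
xor⇒⇔¬ (inj₂ (¬a , b)) = mk⇔ (λ _ → ¬a) (λ _ → b)

xor-comm : ∀ {A B : Set} → A xor B → B xor A
xor-comm (inj₁ (a , ¬b)) = inj₂ (¬b , a)
xor-comm (inj₂ (¬a , b)) = inj₁ (b , ¬a)

xor-¬ : ∀ {A B : Set} → A xor B → (¬ A) xor (¬ B)
xor-¬ (inj₁ (a , ¬b)) = inj₂ ((λ ¬a → ¬a a) , ¬b)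
xor-¬ (inj₂ (¬a , b)) = inj₁ (¬a , λ ¬b → ¬b b)

¬∃⇔∀-of-xor : ∀ {A B : Bool → Bool → Set} → (∀ i j → A i j xor B i j) →
  (¬ ∃₂ A) ⇔ (∀ i j → B i j)
¬∃⇔∀-of-xor {A} {B} A-xor-B = mk⇔ to from
  where
    to : ¬ ∃₂ A → ∀ i j → B i j
    to ¬∃A i j with A-xor-B i j
    ... | inj₁ (a , _) = ⊥-elim (¬∃A (i , j , a))
    ... | inj₂ (_ , b) = b
    from : (∀ i j → B i j) → ¬ ∃₂ A
    from ∀B (i , j , a) with A-xor-B i j
    ... | inj₁ (_ , ¬b) = ¬b (∀B i j)
    ... | inj₂ (¬a , _) = ¬a a

NestedOrDisjointOn : {X : Set} → (X → Set) → (X → Set) → Set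
NestedOrDisjointOn I J =
  (∀ x → I x → J x) ⊎ (∀ x → J x → I x) ⊎ (∀ x → I x → J x → ⊥)

NestedOrDisjointOn-pullback : ∀ {X Y : Set} {I J : X → Set} {I' J' : Y → Set} (f : X → Y) →
  (∀ x → I x ⇔ I' (f x)) → (∀ x → J x ⇔ J' (f x)) →
  NestedOrDisjointOn I' J' → NestedOrDisjointOn I J
NestedOrDisjointOn-pullback f I⇔ J⇔ (inj₁ I'⊆J') =
  inj₁ λ x Ix → Equivalence.from (J⇔ x) (I'⊆J' (f x) (Equivalence.to (I⇔ x) Ix))
NestedOrDisjointOn-pullback f I⇔ J⇔ (inj₂ (inj₁ J'⊆I')) =
  inj₂ (inj₁ λ x Jx → Equivalence.from (I⇔ x) (J'⊆I' (f x) (Equivalence.to (J⇔ x) Jx)))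
NestedOrDisjointOn-pullback f I⇔ J⇔ (inj₂ (inj₂ disjoint)) =
  inj₂ (inj₂ λ x Ix Jx → disjoint (f x) (Equivalence.to (I⇔ x) Ix) (Equivalence.to (J⇔ x) Jx))

AddMod : ℕ → ℕ → ℕ → ℕ → Set
AddMod m s r q = (s + r ≡ q) ⊎ (s + r ≡ q + m)

-- A residue modulo m, given both by its distance q from 0 and its distance r from s.
record Point (m s : ℕ) : Set where
  constructor point
  field
    q r   : ℕ
    q<m   : q < m
    r<m   : r < m
    s+r≡q : AddMod m s r q

ArcFrom0 : ∀ {m s} → ℕ → Point m s → Set
ArcFrom0 d0 p = Point.q p ≤ d0

ArcFromS : ∀ {m s} → ℕ → Point m s → Set
ArcFromS e0 p = Point.r p ≤ e0

StrictlyInside : ℕ → ℕ → Set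
StrictlyInside d x = 0 < x × x < d

-- ChordsCross read off from distances to the first endpoint: the chords {0, d} and {s, t}.
ChordsCross₀ : ℕ → ℕ → ℕ → Set
ChordsCross₀ d s t =
  0 ≢ d × 0 ≢ s × 0 ≢ t × d ≢ s × d ≢ t × s ≢ t × (StrictlyInside d s xor StrictlyInside d t)

module _ {m d0 e0 s t : ℕ} (d+e≤m : suc d0 + suc e0 ≤ m) (s<m : s < m) (t<m : t < m) where
  open Point
  private
    d e : ℕ
    d = suc d0
    e = suc e0

    Outcome : Set
    Outcome = ChordsCross₀ d s t xor NestedOrDisjointOn (ArcFrom0 {m} {s} d0) (ArcFromS e0)

    0<m : 0 < m
    0<m = ≤-<-trans z≤n s<m

    start : Point m s
    start = point s 0 s<m 0<m (inj₁ (+-identityʳ s))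

    origin : 0 < s → Point m s
    origin 0<s = point 0 (m ∸ s) 0<m (∸-monoʳ-< 0<s (<⇒≤ s<m)) (inj₂ (m+[n∸m]≡n (<⇒≤ s<m)))

    s+r<s+e : ∀ {r} → r ≤ e0 → s + r < s + e
    s+r<s+e r≤e0 = +-monoʳ-< s (s≤s r≤e0)

  module NoWrap (s+e≡t : s + e ≡ t) where
    private
      unwrapped : (p : Point m s) → r p ≤ e0 → s + r p ≡ q p
      unwrapped (point _ _ _ _ (inj₁ eq)) _ = eq
      unwrapped (point q r _ _ (inj₂ eq)) r≤e0 =
        ⊥-elim (<⇒≱ (<-trans (subst (s + r <_) s+e≡t (s+r<s+e r≤e0)) t<m)
                    (subst (m ≤_) (sym eq) (m≤n+m m q)))

    same-start : s ≡ 0 → Outcome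
    same-start s≡0 = inj₂ ((λ cross → proj₁ (proj₂ cross) (sym s≡0)) , nested (≤-total d0 e0))
      where
        r≡q : (p : Point m s) → r p ≡ q p
        r≡q (point _ _ _ _ (inj₁ eq)) = subst (λ s → s + _ ≡ _) s≡0 eq
        r≡q (point q r _ r<m (inj₂ eq)) =
          ⊥-elim (<⇒≱ r<m (subst (m ≤_) (sym (subst (λ s → s + r ≡ q + m) s≡0 eq)) (m≤n+m m q)))
        nested : d0 ≤ e0 ⊎ e0 ≤ d0 → NestedOrDisjointOn (ArcFrom0 {m} {s} d0) (ArcFromS e0)
        nested (inj₁ d0≤e0) = inj₁ λ p q≤d0 → subst (_≤ e0) (sym (r≡q p)) (≤-trans q≤d0 d0≤e0)
        nested (inj₂ e0≤d0) = inj₂ (inj₁ λ p r≤e0 → subst (_≤ d0) (r≡q p) (≤-trans r≤e0 e0≤d0))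

    J-inside-I : 0 < s → s < d → t ≤ d → Outcome
    J-inside-I 0<s s<d t≤d = inj₂ (no-cross , inj₂ (inj₁ J⊆I))
      where
        no-cross : ¬ ChordsCross₀ d s t
        no-cross (_ , _ , _ , _ , d≢t , _ , inj₁ (_ , t-outside)) with m≤n⇒m<n∨m≡n t≤d
        ... | inj₁ t<d = t-outside (<-≤-trans (0<s) (subst (s ≤_) s+e≡t (m≤m+n s e)) , t<d)
        ... | inj₂ t≡d = d≢t (sym t≡d)
        no-cross (_ , _ , _ , _ , _ , _ , inj₂ (s-outside , _)) = s-outside (0<s , s<d)
        J⊆I : ∀ p → r p ≤ e0 → q p ≤ d0
        J⊆I p r≤e0 = ≤-pred (≤-trans (subst₂ _<_ (unwrapped p r≤e0) s+e≡t (s+r<s+e r≤e0)) t≤d)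

    endpoints-interleave : 0 < s → s < d → d < t → Outcome
    endpoints-interleave 0<s s<d d<t = inj₁ (cross , not-nested-or-disjoint)
      where
        s+e0<t : s + e0 < t
        s+e0<t = subst (s + e0 <_) s+e≡t (s+r<s+e ≤-refl)
        cross : ChordsCross₀ d s t
        cross = (λ ()) , <⇒≢ 0<s , <⇒≢ (≤-<-trans z≤n d<t) ,
                (λ d≡s → <⇒≢ s<d (sym d≡s)) , <⇒≢ d<t , <⇒≢ (<-trans s<d d<t) ,
                inj₁ ((0<s , s<d) , λ t-inside → <⇒≱ (proj₂ t-inside) (<⇒≤ d<t))
        not-nested-or-disjoint : ¬ NestedOrDisjointOn (ArcFrom0 {m} {s} d0) (ArcFromS e0)
        not-nested-or-disjoint (inj₁ I⊆J) =
          <⇒≱ (<-trans s+e0<t t<m)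
              (subst (_≤ s + e0) (m+[n∸m]≡n (<⇒≤ s<m)) (+-monoʳ-≤ s (I⊆J (origin 0<s) z≤n)))
        not-nested-or-disjoint (inj₂ (inj₁ J⊆I)) =
          <⇒≱ d<t (subst (_≤ d) s+e≡t (subst (_≤ d) (sym (+-suc s e0)) (s≤s (J⊆I last ≤-refl))))
          where
            last : Point m s
            last = point (s + e0) e0 (<-trans s+e0<t t<m) (<-trans (n<1+n e0) (<-≤-trans (m<n+m e (s≤s z≤n)) d+e≤m)) (inj₁ refl)
        not-nested-or-disjoint (inj₂ (inj₂ disjoint)) = disjoint start (≤-pred s<d) z≤n

    J-after-I : d ≤ s → Outcome
    J-after-I d≤s = inj₂ (no-cross , inj₂ (inj₂ disjoint))
      where
        no-cross : ¬ ChordsCross₀ d s t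
        no-cross (_ , _ , _ , _ , _ , _ , inj₁ ((_ , s<d) , _)) = <⇒≱ s<d d≤s
        no-cross (_ , _ , _ , _ , _ , _ , inj₂ (_ , (_ , t<d))) = <⇒≱ t<d (≤-trans d≤s (subst (s ≤_) s+e≡t (m≤m+n s e)))
        disjoint : ∀ p → q p ≤ d0 → r p ≤ e0 → ⊥
        disjoint p q≤d0 r≤e0 = <⇒≱ (s≤s q≤d0) (≤-trans d≤s (subst (s ≤_) (unwrapped p r≤e0) (m≤m+n s (r p))))

  module Wrap (s+e≡t+m : s + e ≡ t + m) where
    private
      t+d≤s : t + d ≤ s
      t+d≤s = +-cancelʳ-≤ e (t + d) s
        (subst ((t + d) + e ≤_) (sym s+e≡t+m) (subst (_≤ t + m) (sym (+-assoc t d e)) (+-monoʳ-≤ t d+e≤m)))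

      d≤s : d ≤ s
      d≤s = ≤-trans (m≤n+m d t) t+d≤s

      unwrapped-impossible : (p : Point m s) → s + r p ≡ q p → q p ≤ d0 → ⊥
      unwrapped-impossible p eq q≤d0 = <⇒≱ (s≤s q≤d0) (≤-trans d≤s (subst (s ≤_) eq (m≤m+n s (r p))))

    J-ends-at-0 : t ≡ 0 → Outcome
    J-ends-at-0 t≡0 = inj₂ ((λ cross → proj₁ (proj₂ (proj₂ cross)) (sym t≡0)) , inj₂ (inj₂ disjoint))
      where
        disjoint : ∀ p → q p ≤ d0 → r p ≤ e0 → ⊥
        disjoint p@(point _ _ _ _ (inj₁ eq)) q≤d0 _ = unwrapped-impossible p eq q≤d0
        disjoint (point q r _ _ (inj₂ eq)) _ r≤e0 =
          <⇒≱ (s+r<s+e r≤e0) (subst₂ _≤_ (sym (trans s+e≡t+m (cong (_+ m) t≡0))) (sym eq) (m≤n+m m q))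

    endpoints-interleave : 0 < t → t < d → Outcome
    endpoints-interleave 0<t t<d = inj₁ (cross , not-nested-or-disjoint)
      where
        d<s : d < s
        d<s = <-≤-trans (m<n+m d 0<t) t+d≤s
        cross : ChordsCross₀ d s t
        cross = (λ ()) , <⇒≢ (≤-<-trans z≤n d<s) , <⇒≢ 0<t ,
                <⇒≢ d<s , (λ d≡t → <⇒≢ t<d (sym d≡t)) , (λ s≡t → <⇒≢ (<-trans t<d d<s) (sym s≡t)) ,
                inj₂ ((λ s-inside → <⇒≱ (proj₂ s-inside) d≤s) , (0<t , t<d))
        not-nested-or-disjoint : ¬ NestedOrDisjointOn (ArcFrom0 {m} {s} d0) (ArcFromS e0)
        not-nested-or-disjoint (inj₁ I⊆J) = 1+n≰n (I⊆J end (≤-pred t<d))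
          where
            end : Point m s
            end = point t e t<m (<-≤-trans (m<n+m e (s≤s z≤n)) d+e≤m) (inj₂ s+e≡t+m)
        not-nested-or-disjoint (inj₂ (inj₁ J⊆I)) = <⇒≱ d<s (<⇒≤ (s≤s (J⊆I start z≤n)))
        not-nested-or-disjoint (inj₂ (inj₂ disjoint)) =
          disjoint (origin (<-trans 0<t (<-≤-trans t<d d≤s))) z≤n
            (m≤n+o⇒m∸n≤o m s (≤-pred (subst (suc m ≤_) (trans (sym s+e≡t+m) (+-suc s e0))
                                               (+-monoˡ-≤ m 0<t))))

    I-inside-J : d ≤ t → Outcome
    I-inside-J d≤t = inj₂ (no-cross , inj₁ I⊆J)
      where
        no-cross : ¬ ChordsCross₀ d s t
        no-cross (_ , _ , _ , _ , _ , _ , inj₁ ((_ , s<d) , _)) = <⇒≱ s<d d≤s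
        no-cross (_ , _ , _ , _ , _ , _ , inj₂ (_ , (_ , t<d))) = <⇒≱ t<d d≤t
        I⊆J : ∀ p → q p ≤ d0 → r p ≤ e0
        I⊆J p@(point _ _ _ _ (inj₁ eq)) q≤d0 = ⊥-elim (unwrapped-impossible p eq q≤d0)
        I⊆J (point q r _ _ (inj₂ eq)) q≤d0 =
          ≤-pred (+-cancelˡ-< s r e (subst₂ _<_ (sym eq) (sym s+e≡t+m) (+-monoˡ-< m (≤-trans (s≤s q≤d0) d≤t))))

  chord-arc₀ : AddMod m s (suc e0) t → Outcome
  chord-arc₀ (inj₁ s+e≡t) with s ≟ 0 | d ≤? s | t ≤? d
  ... | yes s≡0 | _       | _       = NoWrap.same-start s+e≡t s≡0
  ... | no _    | yes d≤s | _       = NoWrap.J-after-I s+e≡t d≤s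
  ... | no s≢0  | no d≰s  | yes t≤d = NoWrap.J-inside-I s+e≡t (n≢0⇒n>0 s≢0) (≰⇒> d≰s) t≤d
  ... | no s≢0  | no d≰s  | no t≰d  = NoWrap.endpoints-interleave s+e≡t (n≢0⇒n>0 s≢0) (≰⇒> d≰s) (≰⇒> t≰d)
  chord-arc₀ (inj₂ s+e≡t+m) with t ≟ 0 | d ≤? t
  ... | yes t≡0 | _       = Wrap.J-ends-at-0 s+e≡t+m t≡0
  ... | no _    | yes d≤t = Wrap.I-inside-J s+e≡t+m d≤t
  ... | no t≢0  | no d≰t  = Wrap.endpoints-interleave s+e≡t+m (n≢0⇒n>0 t≢0) (≰⇒> d≰t)

module Polygon (n : ℕ) where
  open ≡-Reasoning

  +-congʳ-mod : ∀ {a b} k → a ≡[ n ] b → (a + k) ≡[ n ] (b + k)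
  +-congʳ-mod {a} {b} k a≡b = begin
    (a + k) % N n               ≡⟨ %-distribˡ-+ a k (N n) ⟩
    (a % N n + k % N n) % N n   ≡⟨ cong (λ x → (x + k % N n) % N n) a≡b ⟩
    (b % N n + k % N n) % N n   ≡⟨ %-distribˡ-+ b k (N n) ⟨
    (b + k) % N n               ∎

  +-congˡ-mod : ∀ k {a b} → a ≡[ n ] b → (k + a) ≡[ n ] (k + b)
  +-congˡ-mod k {a} {b} a≡b = begin
    (k + a) % N n ≡⟨ cong (_% N n) (+-comm k a) ⟩
    (a + k) % N n ≡⟨ +-congʳ-mod {a} {b} k a≡b ⟩
    (b + k) % N n ≡⟨ cong (_% N n) (+-comm b k) ⟩
    (k + b) % N n ∎

  +N-mod : ∀ a → (a + N n) ≡[ n ] a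
  +N-mod a = [m+n]%n≡m%n a (N n)

  suc-cancel-mod : ∀ {a b} → suc a ≡[ n ] suc b → a ≡[ n ] b
  suc-cancel-mod {a} {b} eq = begin
    a % N n                       ≡⟨ +N-mod a ⟨
    (a + N n) % N n               ≡⟨ cong (_% N n) (+-suc a (suc (n + n))) ⟩
    (suc a + suc (n + n)) % N n   ≡⟨ +-congʳ-mod {suc a} {suc b} (suc (n + n)) eq ⟩
    (suc b + suc (n + n)) % N n   ≡⟨ cong (_% N n) (+-suc b (suc (n + n))) ⟨
    (b + N n) % N n               ≡⟨ +N-mod b ⟩
    b % N n                       ∎

  +-cancelˡ-mod : ∀ k {a b} → (k + a) ≡[ n ] (k + b) → a ≡[ n ] b
  +-cancelˡ-mod zero    eq = eq
  +-cancelˡ-mod (suc k) {a} {b} eq = +-cancelˡ-mod k (suc-cancel-mod {k + a} {k + b} eq)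

  residue-unique : ∀ {x y} → x < N n → y < N n → x ≡[ n ] y → x ≡ y
  residue-unique x<N y<N eq = trans (sym (m<n⇒m%n≡m x<N)) (trans eq (m<n⇒m%n≡m y<N))

  lift-mod : ∀ {x q} → x < N n + N n → q < N n → x ≡[ n ] q → (x ≡ q) ⊎ (x ≡ q + N n)
  lift-mod {x} {q} x<2N q<N eq with x <? N n
  ... | yes x<N = inj₁ (residue-unique x<N q<N eq)
  ... | no x≮N  = inj₂ (trans (sym (m∸n+n≡m N≤x)) (cong (_+ N n) (residue-unique {x ∸ N n} x∸N<N q<N x∸N≡q)))
    where
      N≤x : N n ≤ x
      N≤x = ≮⇒≥ x≮N
      x∸N<N : x ∸ N n < N n
      x∸N<N = +-cancelʳ-< (N n) (x ∸ N n) (N n) (subst (_< N n + N n) (sym (m∸n+n≡m N≤x)) x<2N)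
      x∸N≡q : (x ∸ N n) ≡[ n ] q
      x∸N≡q = trans (sym (+N-mod (x ∸ N n))) (trans (cong (_% N n) (m∸n+n≡m N≤x)) eq)

  dist<N : ∀ a b → dist n a b < N n
  dist<N a b = m%n<n (b % N n + N n ∸ a % N n) (N n)

  +-dist : ∀ a b → (a + dist n a b) ≡[ n ] b
  +-dist a b = begin
    (a + dist n a b) % N n       ≡⟨ +-congʳ-mod {a} {A} (dist n a b) (sym (m%n%n≡m%n a (N n))) ⟩
    (A + dist n a b) % N n       ≡⟨ +-congˡ-mod A {dist n a b} (m%n%n≡m%n (B + N n ∸ A) (N n)) ⟩
    (A + (B + N n ∸ A)) % N n    ≡⟨ cong (_% N n) (m+[n∸m]≡n (≤-trans (m%n≤n a (N n)) (m≤n+m (N n) B))) ⟩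
    (B + N n) % N n              ≡⟨ +N-mod B ⟩
    B % N n                      ≡⟨ m%n%n≡m%n b (N n) ⟩
    b % N n                      ∎
    where
      A B : ℕ
      A = a % N n
      B = b % N n

  dist-unique : ∀ {a b r} → r < N n → (a + r) ≡[ n ] b → dist n a b ≡ r
  dist-unique {a} {b} {r} r<N a+r≡b =
    residue-unique (dist<N a b) r<N (+-cancelˡ-mod a {dist n a b} {r} (trans (+-dist a b) (sym a+r≡b)))

  dist-congˡ : ∀ {a a'} b → a ≡[ n ] a' → dist n a b ≡ dist n a' b
  dist-congˡ b eq = cong (λ x → (b % N n + N n ∸ x) % N n) eq

  dist-congʳ : ∀ a {b b'} → b ≡[ n ] b' → dist n a b ≡ dist n a b'
  dist-congʳ a eq = cong (λ x → (x + N n ∸ a % N n) % N n) eq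

  dist-self : ∀ a → dist n a a ≡ 0
  dist-self a = dist-unique {a} {a} (s≤s z≤n) (cong (_% N n) (+-identityʳ a))

  dist-injective : ∀ a {p p'} → dist n a p ≡ dist n a p' → p ≡[ n ] p'
  dist-injective a {p} {p'} eq =
    trans (sym (+-dist a p)) (trans (cong (λ x → (a + x) % N n) eq) (+-dist a p'))

  dist-≡0 : ∀ {a b} → dist n a b ≡ 0 → a ≡[ n ] b
  dist-≡0 {a} {b} eq = dist-injective a {a} {b} (trans (dist-self a) (sym eq))

  dist-+ : ∀ a c p → AddMod (N n) (dist n a c) (dist n c p) (dist n a p)
  dist-+ a c p = lift-mod (+-mono-< (dist<N a c) (dist<N c p)) (dist<N a p)
    (+-cancelˡ-mod a {s + r} {dist n a p} (begin
      (a + (s + r)) % N n ≡⟨ cong (_% N n) (+-assoc a s r) ⟨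
      (a + s + r) % N n   ≡⟨ +-congʳ-mod {a + s} {c} r (+-dist a c) ⟩
      (c + r) % N n       ≡⟨ +-dist c p ⟩
      p % N n             ≡⟨ +-dist a p ⟨
      (a + dist n a p) % N n ∎))
    where
      s r : ℕ
      s = dist n a c
      r = dist n c p

  distinct-⇔ : ∀ a x y {i j} → dist n a x ≡ i → dist n a y ≡ j → (¬ x ≡[ n ] y) ⇔ (i ≢ j)
  distinct-⇔ a x y refl refl = ¬-cong-⇔ (mk⇔ (dist-congʳ a {x} {y}) (dist-injective a {x} {y}))

  ChordsCross⇔ChordsCross₀ : ∀ a b c c' {d s t} → dist n a b ≡ d → dist n a c ≡ s → dist n a c' ≡ t →
    ChordsCross n (a , b) (c , c') ⇔ ChordsCross₀ d s t
  ChordsCross⇔ChordsCross₀ a b c c' refl refl refl =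
    distinct-⇔ a a b (dist-self a) refl ×-⇔ distinct-⇔ a a c (dist-self a) refl ×-⇔
    distinct-⇔ a a c' (dist-self a) refl ×-⇔ distinct-⇔ a b c refl refl ×-⇔
    distinct-⇔ a b c' refl refl ×-⇔ distinct-⇔ a c c' refl refl ×-⇔ ⇔-refl

  seen-from : ∀ a c → ℕ → Point (N n) (dist n a c)
  seen-from a c p = point (dist n a p) (dist n c p) (dist<N a p) (dist<N c p) (dist-+ a c p)

  module _ (a c : ℕ) (p : Point (N n) (dist n a c)) where
    open Point p

    dist-from-base : dist n a (a + q) ≡ q
    dist-from-base = dist-unique {a} {a + q} q<m refl

    dist-from-second : dist n c (a + q) ≡ r
    dist-from-second = dist-unique {c} {a + q} r<m (begin
      (c + r) % N n       ≡⟨ +-congʳ-mod {c} {a + dist n a c} r (sym (+-dist a c)) ⟩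
      (a + dist n a c + r) % N n ≡⟨ cong (_% N n) (+-assoc a (dist n a c) r) ⟩
      (a + (dist n a c + r)) % N n ≡⟨ unwrap s+r≡q ⟩
      (a + q) % N n       ∎)
      where
        unwrap : AddMod (N n) (dist n a c) r q → (a + (dist n a c + r)) ≡[ n ] (a + q)
        unwrap (inj₁ eq) = cong (λ x → (a + x) % N n) eq
        unwrap (inj₂ eq) = trans (cong (λ x → (a + x) % N n) (trans eq (+-comm q (N n))))
                                 (trans (cong (_% N n) (sym (+-assoc a (N n) q))) (+-congʳ-mod {a + N n} {a} q (+N-mod a)))

  chord-arc : ∀ a b c c' y y' {d0 e0} → suc d0 + suc e0 ≤ N n →
    dist n a b ≡ suc d0 → dist n a y ≡ d0 → dist n c c' ≡ suc e0 → dist n c y' ≡ e0 →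
    ChordsCross n (a , b) (c , c') xor NestedOrDisjoint n (a , y) (c , y')
  chord-arc a b c c' y y' {d0} {e0} d+e≤N ab≡d ay≡d0 cc'≡e cy'≡e0 =
    Equivalence.from (xor-cong-⇔ cross⇔ arcs⇔)
      (chord-arc₀ d+e≤N (dist<N a c) (dist<N a c') (subst (λ e → AddMod (N n) (dist n a c) e (dist n a c')) cc'≡e (dist-+ a c c')))
    where
      cross⇔ : ChordsCross n (a , b) (c , c') ⇔ ChordsCross₀ (suc d0) (dist n a c) (dist n a c')
      cross⇔ = ChordsCross⇔ChordsCross₀ a b c c' ab≡d refl refl
      arcs⇔ : NestedOrDisjoint n (a , y) (c , y') ⇔
              NestedOrDisjointOn (ArcFrom0 {N n} {dist n a c} d0) (ArcFromS e0)
      arcs⇔ = mk⇔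
        (NestedOrDisjointOn-pullback (λ p → a + Point.q p)
          (λ p → mk⇔ (λ q≤d0 → subst₂ _≤_ (sym (dist-from-base a c p)) (sym ay≡d0) q≤d0)
                     (λ inI → subst₂ _≤_ (dist-from-base a c p) ay≡d0 inI))
          (λ p → mk⇔ (λ r≤e0 → subst₂ _≤_ (sym (dist-from-second a c p)) (sym cy'≡e0) r≤e0)
                     (λ inJ → subst₂ _≤_ (dist-from-second a c p) cy'≡e0 inJ)))
        (NestedOrDisjointOn-pullback (seen-from a c)
          (λ p → mk⇔ (subst (dist n a p ≤_) ay≡d0) (subst (dist n a p ≤_) (sym ay≡d0)))
          (λ p → mk⇔ (subst (dist n c p ≤_) cy'≡e0) (subst (dist n c p ≤_) (sym cy'≡e0))))

  StrictlyBetween-flip : ∀ a b c → ¬ a ≡[ n ] b → ¬ a ≡[ n ] c → ¬ b ≡[ n ] c →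
    StrictlyBetween n a b c xor StrictlyBetween n b a c
  StrictlyBetween-flip a b c a≢b a≢c b≢c = by-cases (dist-+ a b c)
    where
      B C X Y : ℕ
      B = dist n a b
      C = dist n a c
      X = dist n b c
      Y = dist n b a
      B+Y≡N : B + Y ≡ N n
      B+Y≡N with dist-+ a b a
      ... | inj₁ eq = ⊥-elim (a≢b (dist-≡0 {a} {b} (m+n≡0⇒m≡0 B (trans eq (dist-self a)))))
      ... | inj₂ eq = trans eq (cong (_+ N n) (dist-self a))
      0<C : 0 < C
      0<C = n≢0⇒n>0 (a≢c ∘ dist-≡0 {a} {c})
      0<X : 0 < X
      0<X = n≢0⇒n>0 (b≢c ∘ dist-≡0 {b} {c})
      by-cases : AddMod (N n) B X C → StrictlyBetween n a b c xor StrictlyBetween n b a c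
      by-cases (inj₁ B+X≡C) =
        inj₂ ((λ (_ , C<B) → <⇒≱ C<B (subst (B ≤_) B+X≡C (m≤m+n B X))) ,
              (0<X , +-cancelˡ-< B X Y (subst₂ _<_ (sym B+X≡C) (sym B+Y≡N) (dist<N a c))))
      by-cases (inj₂ B+X≡C+N) =
        inj₁ ((0<C , +-cancelʳ-< (N n) C B (subst (_< B + N n) B+X≡C+N (+-monoʳ-< B (dist<N b c)))) ,
              λ (_ , X<Y) → <⇒≱ (+-monoʳ-< B X<Y) (subst₂ _≤_ (sym B+Y≡N) (sym B+X≡C+N) (m≤n+m (N n) C)))

  ChordsCross-swapˡ : ∀ {a b c d} → ChordsCross n (a , b) (c , d) → ChordsCross n (b , a) (c , d)
  ChordsCross-swapˡ {a} {b} {c} {d} (a≢b , a≢c , a≢d , b≢c , b≢d , c≢d , c-xor-d) =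
    a≢b ∘ sym , b≢c , b≢d , a≢c , a≢d , c≢d ,
    Equivalence.from (xor-cong-⇔ (xor⇒⇔¬ (StrictlyBetween-flip a b c a≢b a≢c b≢c))
                                 (xor⇒⇔¬ (StrictlyBetween-flip a b d a≢b a≢d b≢d)))
      (xor-¬ c-xor-d)

  ChordsCross-swapʳ : ∀ {a b c d} → ChordsCross n (a , b) (c , d) → ChordsCross n (a , b) (d , c)
  ChordsCross-swapʳ (a≢b , a≢c , a≢d , b≢c , b≢d , c≢d , c-xor-d) =
    a≢b , a≢d , a≢c , b≢d , b≢c , c≢d ∘ sym , xor-comm c-xor-d

  ChordsCross-cong : ∀ {a b c d a' b' c' d'} →
    a ≡[ n ] a' → b ≡[ n ] b' → c ≡[ n ] c' → d ≡[ n ] d' →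
    ChordsCross n (a , b) (c , d) → ChordsCross n (a' , b') (c' , d')
  ChordsCross-cong {a} {b} {c} {d} {a'} {b'} {c'} {d'} a≡a' b≡b' c≡c' d≡d' =
    Equivalence.from (ChordsCross⇔ChordsCross₀ a' b' c' d' (dist-cong b b' b≡b') (dist-cong c c' c≡c') (dist-cong d d' d≡d')) ∘
    Equivalence.to (ChordsCross⇔ChordsCross₀ a b c d refl refl refl)
    where
      dist-cong : ∀ x x' → x ≡[ n ] x' → dist n a' x' ≡ dist n a x
      dist-cong x x' x≡x' = trans (dist-congʳ a' {x'} {x} (sym x≡x')) (dist-congˡ {a'} {a} x (sym a≡a'))

  ChordEq-sym : ∀ c c' → ChordEq n c c' → ChordEq n c' c
  ChordEq-sym _ _ (inj₁ (a≡a' , b≡b')) = inj₁ (sym a≡a' , sym b≡b')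
  ChordEq-sym _ _ (inj₂ (a≡b' , b≡a')) = inj₂ (sym b≡a' , sym a≡b')

  ChordsCross-resp : ∀ c c' e e' → ChordEq n c c' → ChordEq n e e' → ChordsCross n c e → ChordsCross n c' e'
  ChordsCross-resp (a , b) (a' , b') (c , d) (c' , d') c≈c' e≈e' = resp-second e≈e' ∘ resp-first c≈c'
    where
      resp-first : ChordEq n (a , b) (a' , b') → ChordsCross n (a , b) (c , d) → ChordsCross n (a' , b') (c , d)
      resp-first (inj₁ (a≡a' , b≡b')) = ChordsCross-cong {a} {b} {c} {d} {a'} {b'} {c} {d} a≡a' b≡b' refl refl
      resp-first (inj₂ (a≡b' , b≡a')) =
        ChordsCross-cong {b} {a} {c} {d} {a'} {b'} {c} {d} b≡a' a≡b' refl refl ∘ ChordsCross-swapˡ {a} {b} {c} {d}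
      resp-second : ChordEq n (c , d) (c' , d') → ChordsCross n (a' , b') (c , d) → ChordsCross n (a' , b') (c' , d')
      resp-second (inj₁ (c≡c' , d≡d')) = ChordsCross-cong {a'} {b'} {c} {d} {a'} {b'} {c'} {d'} refl refl c≡c' d≡d'
      resp-second (inj₂ (c≡d' , d≡c')) =
        ChordsCross-cong {a'} {b'} {d} {c} {a'} {b'} {c'} {d'} refl refl d≡c' c≡d' ∘ ChordsCross-swapʳ {a'} {b'} {c} {d}

module BDiagonals (n : ℕ) where
  open Polygon n

  chordOf : ℕ → ℕ → Bool → Chord
  chordOf u v b = (u + shift n b , v + shift n b)

  chordSel : Chord × Chord → Bool → Chord
  chordSel (c₁ , _) false = c₁
  chordSel (_ , c₂) true  = c₂

  Cross⇔∃ : ∀ (D E : BDiag n) →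
    Cross D E ⇔ ∃₂ λ i j → ChordsCross n (chordSel (chords D) i) (chordSel (chords E) j)
  Cross⇔∃ D E = mk⇔ to from
    where
      to : Cross D E → ∃₂ λ i j → ChordsCross n (chordSel (chords D) i) (chordSel (chords E) j)
      to (inj₁ x)               = false , false , x
      to (inj₂ (inj₁ x))        = false , true , x
      to (inj₂ (inj₂ (inj₁ x))) = true , false , x
      to (inj₂ (inj₂ (inj₂ x))) = true , true , x
      from : (∃₂ λ i j → ChordsCross n (chordSel (chords D) i) (chordSel (chords E) j)) → Cross D E
      from (false , false , x) = inj₁ x
      from (false , true , x)  = inj₂ (inj₁ x)
      from (true , false , x)  = inj₂ (inj₂ (inj₁ x))
      from (true , true , x)   = inj₂ (inj₂ (inj₂ x))

  chordOf-false : ∀ c u v → ChordEq n c (u , v) → ChordEq n c (chordOf u v false)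
  chordOf-false c u v = subst (ChordEq n c) (sym (cong₂ _,_ (+-identityʳ u) (+-identityʳ v)))

  WrittenAs⇒chordOf : ∀ D u v → WrittenAs D u v →
    (∀ i → ∃[ b ] ChordEq n (chordSel (chords D) i) (chordOf u v b)) ×
    (∀ b → ∃[ i ] ChordEq n (chordSel (chords D) i) (chordOf u v b))
  WrittenAs⇒chordOf D u v (_ , inj₁ (c₁≈ , c₂≈)) =
    (λ { false → false , chordOf-false (proj₁ (chords D)) u v c₁≈ ; true → true , c₂≈ }) ,
    (λ { false → false , chordOf-false (proj₁ (chords D)) u v c₁≈ ; true → true , c₂≈ })
  WrittenAs⇒chordOf D u v (_ , inj₂ (c₁≈ , c₂≈)) =
    (λ { false → true , c₁≈ ; true → false , chordOf-false (proj₂ (chords D)) u v c₂≈ }) ,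
    (λ { false → true , chordOf-false (proj₂ (chords D)) u v c₂≈ ; true → false , c₁≈ })

  Cross⇔chordOf-cross : ∀ {D₁ D₂ u₁ v₁ u₂ v₂} → WrittenAs D₁ u₁ v₁ → WrittenAs D₂ u₂ v₂ →
    Cross D₁ D₂ ⇔ ∃₂ λ b₁ b₂ → ChordsCross n (chordOf u₁ v₁ b₁) (chordOf u₂ v₂ b₂)
  Cross⇔chordOf-cross {D₁} {D₂} {u₁} {v₁} {u₂} {v₂} w₁ w₂ = ⇔-trans (Cross⇔∃ D₁ D₂) (mk⇔ to from)
    where
      to : (∃₂ λ i j → ChordsCross n (chordSel (chords D₁) i) (chordSel (chords D₂) j)) →
           ∃₂ λ b₁ b₂ → ChordsCross n (chordOf u₁ v₁ b₁) (chordOf u₂ v₂ b₂)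
      to (i , j , x) with proj₁ (WrittenAs⇒chordOf D₁ u₁ v₁ w₁) i | proj₁ (WrittenAs⇒chordOf D₂ u₂ v₂ w₂) j
      ... | b₁ , c₁≈ | b₂ , c₂≈ =
        b₁ , b₂ , ChordsCross-resp (chordSel (chords D₁) i) (chordOf u₁ v₁ b₁)
                                   (chordSel (chords D₂) j) (chordOf u₂ v₂ b₂) c₁≈ c₂≈ x
      from : (∃₂ λ b₁ b₂ → ChordsCross n (chordOf u₁ v₁ b₁) (chordOf u₂ v₂ b₂)) →
             ∃₂ λ i j → ChordsCross n (chordSel (chords D₁) i) (chordSel (chords D₂) j)
      from (b₁ , b₂ , x) with proj₂ (WrittenAs⇒chordOf D₁ u₁ v₁ w₁) b₁ | proj₂ (WrittenAs⇒chordOf D₂ u₂ v₂ w₂) b₂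
      ... | i , c₁≈ | j , c₂≈ =
        i , j , ChordsCross-resp (chordOf u₁ v₁ b₁) (chordSel (chords D₁) i)
                                 (chordOf u₂ v₂ b₂) (chordSel (chords D₂) j) (ChordEq-sym (chordSel (chords D₁) i) (chordOf u₁ v₁ b₁) c₁≈)
                                 (ChordEq-sym (chordSel (chords D₂) j) (chordOf u₂ v₂ b₂) c₂≈) x

  dist-shifted : ∀ u v {k} h → k < N n → v ≡[ n ] (u + k) → dist n (u + h) (v + h) ≡ k
  dist-shifted u v {k} h k<N v≡u+k = dist-unique {u + h} {v + h} k<N (begin
    (u + h + k) % N n ≡⟨ cong (_% N n) (xy∙z≈xz∙y u h k) ⟩
    (u + k + h) % N n ≡⟨ +-congʳ-mod {u + k} {v} h (sym v≡u+k) ⟩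
    (v + h) % N n     ∎)
    where open ≡-Reasoning

  arc-end : ∀ u v {d0} → v ≡[ n ] (u + suc d0) → (v + (N n ∸ 1)) ≡[ n ] (u + d0)
  arc-end u v {d0} v≡u+d = begin
    (v + suc (n + n)) % N n            ≡⟨ +-congʳ-mod {v} {u + suc d0} (suc (n + n)) v≡u+d ⟩
    (u + suc d0 + suc (n + n)) % N n   ≡⟨ cong (λ x → (x + suc (n + n)) % N n) (+-suc u d0) ⟩
    (suc (u + d0) + suc (n + n)) % N n ≡⟨ cong (_% N n) (+-suc (u + d0) (suc (n + n))) ⟨
    (u + d0 + N n) % N n               ≡⟨ +N-mod (u + d0) ⟩
    (u + d0) % N n                     ∎
    where open ≡-Reasoning

  ≤n+1⇒<N : ∀ {k} → k ≤ suc n → k < N n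
  ≤n+1⇒<N k≤n+1 = <-≤-trans (s≤s k≤n+1) (m≤m+n (suc (suc n)) n)

  dist-chordOf : ∀ u v {d} b → d ≤ suc n → v ≡[ n ] (u + d) →
    dist n (u + shift n b) (v + shift n b) ≡ d
  dist-chordOf u v b d≤n+1 = dist-shifted u v (shift n b) (≤n+1⇒<N d≤n+1)

  dist-arcOf : ∀ u v {d0} b → suc d0 ≤ suc n → v ≡[ n ] (u + suc d0) →
    dist n (u + shift n b) (v + (N n ∸ 1) + shift n b) ≡ d0
  dist-arcOf u v b d≤n+1 v≡u+d =
    dist-shifted u (v + (N n ∸ 1)) (shift n b) (≤n+1⇒<N (<⇒≤ d≤n+1)) (arc-end u v v≡u+d)

  chordOf-xor-arcOf : ∀ {u₁ v₁ u₂ v₂ d e} → 1 ≤ d → d ≤ suc n → 1 ≤ e → e ≤ suc n →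
    v₁ ≡[ n ] (u₁ + d) → v₂ ≡[ n ] (u₂ + e) → ∀ b₁ b₂ →
    ChordsCross n (chordOf u₁ v₁ b₁) (chordOf u₂ v₂ b₂) xor
    NestedOrDisjoint n (arcOf n u₁ v₁ b₁) (arcOf n u₂ v₂ b₂)
  chordOf-xor-arcOf {u₁} {v₁} {u₂} {v₂} {suc d0} {suc e0} (s≤s _) d≤n+1 (s≤s _) e≤n+1 v₁≡ v₂≡ b₁ b₂ =
    chord-arc (u₁ + shift n b₁) (v₁ + shift n b₁) (u₂ + shift n b₂) (v₂ + shift n b₂)
              (v₁ + (N n ∸ 1) + shift n b₁) (v₂ + (N n ∸ 1) + shift n b₂) d+e≤N
              (dist-chordOf u₁ v₁ b₁ d≤n+1 v₁≡) (dist-arcOf u₁ v₁ b₁ d≤n+1 v₁≡)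
              (dist-chordOf u₂ v₂ b₂ e≤n+1 v₂≡) (dist-arcOf u₂ v₂ b₂ e≤n+1 v₂≡)
    where
      d+e≤N : suc d0 + suc e0 ≤ N n
      d+e≤N = subst (suc d0 + suc e0 ≤_) (cong suc (+-suc n n)) (+-mono-≤ d≤n+1 e≤n+1)

theorem4p3 : (n : ℕ) → 1 ≤ n → (D₁ D₂ : BDiag n) → (u₁ v₁ u₂ v₂ : ℕ) →
    WrittenAs D₁ u₁ v₁ → WrittenAs D₂ u₂ v₂ →
    Noncrossing D₁ D₂ ⇔
    (∀ (b₁ b₂ : Bool) → NestedOrDisjoint n (arcOf n u₁ v₁ b₁) (arcOf n u₂ v₂ b₂))
theorem4p3 n _ D₁ D₂ u₁ v₁ u₂ v₂ w₁@((d , 2≤d , d≤n+1 , v₁≡) , _) w₂@((e , 2≤e , e≤n+1 , v₂≡) , _) =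
  ⇔-trans (¬-cong-⇔ (Cross⇔chordOf-cross {D₁} {D₂} {u₁} {v₁} {u₂} {v₂} w₁ w₂))
          (¬∃⇔∀-of-xor (chordOf-xor-arcOf {u₁} {v₁} {u₂} {v₂} {d} {e} (<⇒≤ 2≤d) d≤n+1 (<⇒≤ 2≤e) e≤n+1 v₁≡ v₂≡))
  where open BDiagonals n
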